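{- Let $a,n$ be positive integers with $n\geqslant 5$ and $a\leqslant n/2$. Then \[p(a,n)\geqslant \frac{2a}{n},\] with equality if and only if $a=n/2$.
   Context: $p(a,n)$ is the probability that a subset $U\subseteq\{1,\dots,n\}$, chosen uniformly at random among all subsets of cardinality $\lfloor (n+3)/2\rfloor$, contains both elements of at least one of the pairs $\{1,2\},\{3,4\},\dots,\{2a-1,2a\}$ (equivalently, of any fixed family of $a$ pairwise disjoint $2$-element subsets of $\{1,\dots,n\}$). -}

module Defs where

open import Data.Bool using (Bool; true; false; _∧_; _∨_)
open import Data.Nat using (ℕ; zero; suc; _+_; _*_; _/_; _≡ᵇ_; NonZero)
open import Data.List using (List; []; _∷_; map; _++_; filter; length)
open import Data.Vec using (Vec; []; _∷_)
open import Data.Fin.Subset using (Subset; Side; inside; outside; ∣_∣)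
open import Data.Integer using (+_)
open import Relation.Nullary.Decidable using (Dec; yes; no)
open import Relation.Binary.PropositionalEquality using (_≡_)
import Data.Rational as ℚ

allSubsets : (n : ℕ) → List (Subset n)
allSubsets zero = [] ∷ []
allSubsets (suc n) = map (inside ∷_) (allSubsets n) ++ map (outside ∷_) (allSubsets n)

-- membership of the element with (0-based) index i; false if i ≥ n
memℕ : {n : ℕ} → ℕ → Subset n → Bool
memℕ i [] = false
memℕ zero (inside ∷ U) = true
memℕ zero (outside ∷ U) = false
memℕ (suc i) (_ ∷ U) = memℕ i U

sampleSize : ℕ → ℕ
sampleSize n = (n + 3) / 2

-- U contains both elements of one of the pairs {2i-1,2i}, 1 ≤ i ≤ a
-- (0-based: {2j, 2j+1}, 0 ≤ j < a)
containsPair : {n : ℕ} → ℕ → Subset n → Bool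
containsPair zero U = false
containsPair (suc j) U = (memℕ (2 * j) U ∧ memℕ (suc (2 * j)) U) ∨ containsPair j U

isTrue : (b : Bool) → Dec (b ≡ true)
isTrue true = yes Relation.Binary.PropositionalEquality.refl
isTrue false = no (λ ())

sampleSpace : (n : ℕ) → List (Subset n)
sampleSpace n = filter (λ U → isTrue (∣ U ∣ ≡ᵇ sampleSize n)) (allSubsets n)

favourable : (a n : ℕ) → List (Subset n)
favourable a n = filter (λ U → isTrue (containsPair a U)) (sampleSpace n)

p : (a n : ℕ) → .{{_ : NonZero (length (sampleSpace n))}} → ℚ.ℚ
p a n = (+ length (favourable a n)) ℚ./ length (sampleSpace n)

module Submission where

-- Write n = 2a + m, k = ⌊(n+3)/2⌋, and V(a,n,k) for the number of k-subsets of {0,…,n-1}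
-- containing no pair {2i, 2i+1}, i < a.  As p(a,n) = 1 - V/C(n,k), the bound p(a,n) ≥ 2a/n is
-- n·V ≤ m·C(n,k), proved for all k with n + 2 ≤ 2k by induction on a.  The pair recursion
-- V(a+1, N+2, j+2) = V(a, N, j+2) + 2·V(a, N, j+1) reduces the step to the fact that the
-- (j+2)-subsets of an (N+2)-set avoiding a fixed pair form at most the proportion N/(N+2) of
-- all of them; by Pascal's rule and absorption this is 2(N+1) ≤ (j+1)(j+2), true for N ≤ 2j
-- and strict for j ≥ 2.  The file develops: counting over the list of all subsets; counts of
-- k-subsets and of avoiding subsets with the pair recursion; the binomial inequality; the
-- inductive bound on V; facts on the sample size; the translation to the rational p(a,n).
-- For 2a = n no sample avoids all pairs, so p = 1 = 2a/n; for 2a < n the last induction step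
-- is strict because n ≥ 5 forces 4 ≤ k ≤ n.

open import Defs
open import Data.Nat using (ℕ; _*_; _≤_; NonZero)
open import Data.Integer using (+_)
open import Data.List using (length)
open import Data.Rational using (ℚ) renaming (_≤_ to _≤ℚ_; _/_ to _/ℚ_)
open import Data.Product using (_×_)
open import Function.Bundles using (_⇔_)
open import Relation.Binary.PropositionalEquality using (_≡_)

open import Data.Bool using (Bool; true; false; _∧_; _∨_; not; if_then_else_)
open import Data.Bool.Properties using (∧-zeroʳ; ∧-identityʳ; ∨-assoc; ∨-comm)
open import Data.Empty using (⊥-elim)
open import Data.Fin.Subset using (Subset; inside; outside; ∣_∣)
open import Data.Integer.Properties using (pos-*)
import Data.Integer as ℤ
open import Data.List using (List; []; _∷_; map; _++_; filter)
open import Data.Nat using (zero; suc; pred; _+_; _<_; _≡ᵇ_; z≤n; s≤s; >-nonZero)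
open import Data.Nat.Combinatorics using (_C_; nC1≡n)
  renaming (nCk+nC[k+1]≡[n+1]C[k+1] to pascal)
open import Data.Nat.DivMod using (_%_; m≡m%n+[m/n]*n; m%n<n; m/n*n≤m)
open import Data.Nat.Properties
open import Data.Nat.Tactic.RingSolver using (solve-∀)
open import Data.Product using (_,_; proj₂; uncurry)
open import Data.Rational using (toℚᵘ) renaming (_<_ to _<ℚ_)
open import Data.Rational.Properties using (toℚᵘ-fromℚᵘ; toℚᵘ-cancel-≤; toℚᵘ-cancel-<; toℚᵘ-injective)
  renaming (<-irrefl to <ℚ-irrefl)
open import Data.Rational.Unnormalised using (mkℚᵘ; *≤*; *<*; *≡*) renaming (_≃_ to _≃ᵘ_)
open import Data.Rational.Unnormalised.Properties using (≤-respˡ-≃; ≤-respʳ-≃; <-respˡ-≃; <-respʳ-≃; ≃-sym; ≃-trans)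
open import Data.Vec using (_∷_)
open import Function.Bundles using (mk⇔)
open import Relation.Binary.PropositionalEquality using (refl; sym; trans; cong; cong₂; subst; subst₂; module ≡-Reasoning)

open import Algebra.Properties.CommutativeSemigroup *-commutativeSemigroup using (x∙yz≈y∙xz)

count : {A : Set} → (A → Bool) → List A → ℕ
count f []       = 0
count f (x ∷ xs) = if f x then suc (count f xs) else count f xs

length-filter : {A : Set} (f : A → Bool) (xs : List A) →
                length (filter (λ x → isTrue (f x)) xs) ≡ count f xs
length-filter f []       = refl
length-filter f (x ∷ xs) with f x
... | true  = cong suc (length-filter f xs)
... | false = length-filter f xs

count-filter : {A : Set} (f g : A → Bool) (xs : List A) →
               count g (filter (λ x → isTrue (f x)) xs) ≡ count (λ x → f x ∧ g x) xs
count-filter f g []       = refl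
count-filter f g (x ∷ xs) with f x
... | false = count-filter f g xs
... | true with g x
...   | true  = cong suc (count-filter f g xs)
...   | false = count-filter f g xs

count-++ : {A : Set} (f : A → Bool) (xs ys : List A) →
           count f (xs ++ ys) ≡ count f xs + count f ys
count-++ f []       ys = refl
count-++ f (x ∷ xs) ys with f x
... | true  = cong suc (count-++ f xs ys)
... | false = count-++ f xs ys

count-map : {A B : Set} (f : B → Bool) (g : A → B) (xs : List A) →
            count f (map g xs) ≡ count (λ x → f (g x)) xs
count-map f g []       = refl
count-map f g (x ∷ xs) with f (g x)
... | true  = cong suc (count-map f g xs)
... | false = count-map f g xs

count-cong : {A : Set} {f g : A → Bool} (xs : List A) → (∀ x → f x ≡ g x) →
             count f xs ≡ count g xs
count-cong []       f≗g = refl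
count-cong {g = g} (x ∷ xs) f≗g rewrite f≗g x with g x
... | true  = cong suc (count-cong xs f≗g)
... | false = count-cong xs f≗g

count-false : {A : Set} (xs : List A) → count (λ _ → false) xs ≡ 0
count-false []       = refl
count-false (x ∷ xs) = count-false xs

count-split : {A : Set} (f g : A → Bool) (xs : List A) →
              count f xs ≡ count (λ x → f x ∧ g x) xs + count (λ x → f x ∧ not (g x)) xs
count-split f g []       = refl
count-split f g (x ∷ xs) with f x
... | false = count-split f g xs
... | true with g x
...   | true  = cong suc (count-split f g xs)
...   | false = trans (cong suc (count-split f g xs)) (sym (+-suc _ _))

count-allSubsets : ∀ n (f : Subset (suc n) → Bool) →
  count f (allSubsets (suc n)) ≡
  count (λ U → f (inside ∷ U)) (allSubsets n) + count (λ U → f (outside ∷ U)) (allSubsets n)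
count-allSubsets n f = trans (count-++ f (map (inside ∷_) (allSubsets n)) _)
  (cong₂ _+_ (count-map f (inside ∷_) (allSubsets n)) (count-map f (outside ∷_) (allSubsets n)))

hasSize : {n : ℕ} → ℕ → Subset n → Bool
hasSize k U = ∣ U ∣ ≡ᵇ k

avoiding : ℕ → ℕ → ℕ → ℕ
avoiding a n k = count (λ U → hasSize k U ∧ not (containsPair a U)) (allSubsets n)

meeting : ℕ → ℕ → ℕ → ℕ
meeting a n k = count (λ U → hasSize k U ∧ containsPair a U) (allSubsets n)

count-hasSize : ∀ n k → count (hasSize k) (allSubsets n) ≡ n C k
count-hasSize zero    zero    = refl
count-hasSize zero    (suc k) = refl
count-hasSize (suc n) zero    =
  trans (count-allSubsets n (hasSize 0))
        (cong₂ _+_ (count-false (allSubsets n)) (count-hasSize n zero))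
count-hasSize (suc n) (suc k) =
  trans (count-allSubsets n (hasSize (suc k)))
        (trans (cong₂ _+_ (count-hasSize n k) (count-hasSize n (suc k))) (pascal n k))

meeting+avoiding : ∀ a n k → meeting a n k + avoiding a n k ≡ n C k
meeting+avoiding a n k =
  trans (sym (count-split (hasSize k) (containsPair a) (allSubsets n))) (count-hasSize n k)

avoiding≤binomial : ∀ a n k → avoiding a n k ≤ n C k
avoiding≤binomial a n k = subst (avoiding a n k ≤_) (meeting+avoiding a n k) (m≤n+m _ _)

avoiding-none : ∀ n k → avoiding 0 n k ≡ n C k
avoiding-none n k = trans (count-cong (allSubsets n) (λ U → ∧-identityʳ _)) (count-hasSize n k)

containsPair-cons₂ : ∀ {n} a x y (U : Subset n) →
                     containsPair (suc a) (x ∷ y ∷ U) ≡ (x ∧ y) ∨ containsPair a U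
containsPair-cons₂ zero    inside  inside  U = refl
containsPair-cons₂ zero    inside  outside U = refl
containsPair-cons₂ zero    outside y       U = refl
containsPair-cons₂ (suc a) x       y       U = begin
  (memℕ (2 * suc a) V ∧ memℕ (suc (2 * suc a)) V) ∨ containsPair (suc a) V
    ≡⟨ cong (λ i → (memℕ i V ∧ memℕ (suc i) V) ∨ containsPair (suc a) V) (*-suc 2 a) ⟩
  pairA ∨ containsPair (suc a) V
    ≡⟨ cong (pairA ∨_) (containsPair-cons₂ a x y U) ⟩
  pairA ∨ ((x ∧ y) ∨ containsPair a U)
    ≡⟨ sym (∨-assoc pairA (x ∧ y) _) ⟩
  (pairA ∨ (x ∧ y)) ∨ containsPair a U
    ≡⟨ cong (_∨ containsPair a U) (∨-comm pairA (x ∧ y)) ⟩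
  ((x ∧ y) ∨ pairA) ∨ containsPair a U
    ≡⟨ ∨-assoc (x ∧ y) pairA _ ⟩
  (x ∧ y) ∨ (pairA ∨ containsPair a U) ∎
  where
  open ≡-Reasoning
  V = x ∷ y ∷ U
  pairA = memℕ (2 * a) U ∧ memℕ (suc (2 * a)) U

-- The pair recursion: a (k+1)-subset of {x, y} ∪ S avoiding the pair {x, y} and a further
-- pairs of S contains neither x nor y, or exactly one of them.
avoiding-step : ∀ a n k → avoiding (suc a) (2 + n) (suc k) ≡ avoiding a n (suc k) + 2 * avoiding a n k
avoiding-step a n k = begin
  avoiding (suc a) (2 + n) (suc k)
    ≡⟨ count-allSubsets (suc n) F ⟩
  count (λ U → F (inside ∷ U)) (allSubsets (suc n)) + count (λ U → F (outside ∷ U)) (allSubsets (suc n))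
    ≡⟨ cong₂ _+_ (count-allSubsets n _) (count-allSubsets n _) ⟩
  (after inside inside + after inside outside) + (after outside inside + after outside outside)
    ≡⟨ cong₂ _+_ (cong₂ _+_ bothInside (onlyRest inside outside refl)) (cong₂ _+_ (onlyRest outside inside refl) (onlyRest outside outside refl)) ⟩
  (0 + avoiding a n k) + (avoiding a n k + avoiding a n (suc k))
    ≡⟨ rearrange (avoiding a n k) (avoiding a n (suc k)) ⟩
  avoiding a n (suc k) + 2 * avoiding a n k ∎
  where
  open ≡-Reasoning
  F : Subset (2 + n) → Bool
  F U = hasSize (suc k) U ∧ not (containsPair (suc a) U)
  after : Bool → Bool → ℕ
  after x y = count (λ U → F (x ∷ y ∷ U)) (allSubsets n)
  firstPair : ∀ x y U → F (x ∷ y ∷ U) ≡ hasSize (suc k) (x ∷ y ∷ U) ∧ not ((x ∧ y) ∨ containsPair a U)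
  firstPair x y U = cong (λ b → hasSize (suc k) (x ∷ y ∷ U) ∧ not b) (containsPair-cons₂ a x y U)
  bothInside : after inside inside ≡ 0
  bothInside = trans (count-cong (allSubsets n) (λ U → trans (firstPair inside inside U) (∧-zeroʳ _)))
                     (count-false (allSubsets n))
  onlyRest : ∀ x y → x ∧ y ≡ false →
             after x y ≡ count (λ U → hasSize (suc k) (x ∷ y ∷ U) ∧ not (containsPair a U)) (allSubsets n)
  onlyRest x y notBoth = count-cong (allSubsets n) (λ U → trans (firstPair x y U)
    (cong (λ b → hasSize (suc k) (x ∷ y ∷ U) ∧ not (b ∨ containsPair a U)) notBoth))
  rearrange : ∀ u v → (0 + u) + (u + v) ≡ v + 2 * u
  rearrange = solve-∀

binomial-pos : ∀ {n k} → k ≤ n → 1 ≤ n C k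
binomial-pos {n}     {zero}  _         = ≤-refl
binomial-pos {suc n} {suc k} (s≤s k≤n) =
  ≤-trans (binomial-pos k≤n) (subst (n C k ≤_) (pascal n k) (m≤m+n _ _))

absorption : ∀ n k → suc k * (suc n C suc k) ≡ suc n * (n C k)
absorption zero    zero    = refl
absorption zero    (suc k) = *-zeroʳ (2 + k)
absorption (suc n) zero    = trans (+-identityʳ _) (trans (nC1≡n (2 + n)) (sym (*-identityʳ (2 + n))))
absorption (suc n) (suc k) = begin
  suc (suc k) * (suc (suc n) C suc (suc k))      ≡⟨ cong (suc (suc k) *_) (sym (pascal (suc n) (suc k))) ⟩
  suc (suc k) * (X + Y)                          ≡⟨ *-distribˡ-+ (suc (suc k)) X Y ⟩
  (X + suc k * X) + suc (suc k) * Y              ≡⟨ cong₂ (λ u v → (X + u) + v) (absorption n k) (absorption n (suc k)) ⟩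
  (X + suc n * (n C k)) + suc n * (n C suc k)    ≡⟨ +-assoc X _ _ ⟩
  X + (suc n * (n C k) + suc n * (n C suc k))    ≡⟨ cong (λ u → X + u) (sym (*-distribˡ-+ (suc n) (n C k) (n C suc k))) ⟩
  X + suc n * (n C k + n C suc k)                ≡⟨ cong (λ u → X + suc n * u) (pascal n k) ⟩
  suc (suc n) * X                                ∎
  where
  open ≡-Reasoning
  X = suc n C suc k
  Y = suc n C suc (suc k)

-- The number of (j+2)-subsets of an (N+2)-set avoiding a fixed pair of its points:
-- those containing neither point of the pair, or exactly one of them.
pairFree : ℕ → ℕ → ℕ
pairFree N j = N C suc (suc j) + 2 * (N C suc j)

-- Pascal's rule twice: the (j+2)-subsets are the pair-free ones and those containing the pair.
pascal₂ : ∀ N j → suc (suc N) C suc (suc j) ≡ pairFree N j + N C j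
pascal₂ N j = begin
  suc (suc N) C suc (suc j)                     ≡⟨ sym (pascal (suc N) (suc j)) ⟩
  suc N C suc j + suc N C suc (suc j)           ≡⟨ cong₂ _+_ (sym (pascal N j)) (sym (pascal N (suc j))) ⟩
  (N C j + N C suc j) + (N C suc j + N C suc (suc j)) ≡⟨ regroup (N C j) (N C suc j) (N C suc (suc j)) ⟩
  pairFree N j + N C j                          ∎
  where
  open ≡-Reasoning
  regroup : ∀ b₀ b₁ b₂ → (b₀ + b₁) + (b₁ + b₂) ≡ (b₂ + 2 * b₁) + b₀
  regroup = solve-∀

doubleAbsorption : ∀ N j →
  suc j * suc (suc j) * (suc (suc N) C suc (suc j)) ≡ suc N * (suc (suc N) * (N C j))
doubleAbsorption N j = begin
  suc j * suc (suc j) * c        ≡⟨ *-assoc (suc j) (suc (suc j)) c ⟩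
  suc j * (suc (suc j) * c)      ≡⟨ cong (suc j *_) (absorption (suc N) (suc j)) ⟩
  suc j * (suc (suc N) * X)      ≡⟨ x∙yz≈y∙xz (suc j) (suc (suc N)) X ⟩
  suc (suc N) * (suc j * X)      ≡⟨ cong (suc (suc N) *_) (absorption N j) ⟩
  suc (suc N) * (suc N * (N C j)) ≡⟨ x∙yz≈y∙xz (suc (suc N)) (suc N) (N C j) ⟩
  suc N * (suc (suc N) * (N C j)) ∎
  where
  open ≡-Reasoning
  c = suc (suc N) C suc (suc j)
  X = suc N C suc j

rowProduct : ∀ j → suc j * suc (suc j) ≡ j * j + (3 * j + 2)
rowProduct = solve-∀

twiceOdd : ∀ j → 2 * suc (2 * j) ≡ j + (3 * j + 2)
twiceOdd = solve-∀

quadraticBound : ∀ N j → N ≤ 2 * j → 2 * suc N ≤ suc j * suc (suc j)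
quadraticBound N zero      z≤n   = ≤-refl
quadraticBound N j@(suc _) N≤2j = begin
  2 * suc N            ≤⟨ *-monoʳ-≤ 2 (s≤s N≤2j) ⟩
  2 * suc (2 * j)      ≡⟨ twiceOdd j ⟩
  j + (3 * j + 2)      ≤⟨ +-monoˡ-≤ (3 * j + 2) (m≤m*n j j) ⟩
  j * j + (3 * j + 2)  ≡⟨ rowProduct j ⟨
  suc j * suc (suc j)  ∎
  where open ≤-Reasoning

quadraticBound-< : ∀ N j → N ≤ 2 * j → 2 ≤ j → 2 * suc N < suc j * suc (suc j)
quadraticBound-< N j@(suc _) N≤2j 2≤j = begin-strict
  2 * suc N            ≤⟨ *-monoʳ-≤ 2 (s≤s N≤2j) ⟩
  2 * suc (2 * j)      ≡⟨ twiceOdd j ⟩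
  j + (3 * j + 2)      <⟨ +-monoˡ-< (3 * j + 2) (m<m*n j j 2≤j) ⟩
  j * j + (3 * j + 2)  ≡⟨ rowProduct j ⟨
  suc j * suc (suc j)  ∎
  where open ≤-Reasoning

scaledTwoStep : ∀ N j →
  suc j * suc (suc j) * (2 * (suc (suc N) C suc (suc j))) ≡ 2 * suc N * (suc (suc N) * (N C j))
scaledTwoStep N j = begin
  D * (2 * c)                       ≡⟨ x∙yz≈y∙xz D 2 c ⟩
  2 * (D * c)                       ≡⟨ cong (2 *_) (doubleAbsorption N j) ⟩
  2 * (suc N * (suc (suc N) * (N C j))) ≡⟨ *-assoc 2 (suc N) _ ⟨
  2 * suc N * (suc (suc N) * (N C j)) ∎
  where
  open ≡-Reasoning
  D = suc j * suc (suc j)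
  c = suc (suc N) C suc (suc j)

twoStepBound : ∀ N j → N ≤ 2 * j → 2 * (suc (suc N) C suc (suc j)) ≤ suc (suc N) * (N C j)
twoStepBound N j N≤2j = *-cancelˡ-≤ (suc j * suc (suc j))
  (subst (_≤ suc j * suc (suc j) * (suc (suc N) * (N C j))) (sym (scaledTwoStep N j)) (*-monoˡ-≤ (suc (suc N) * (N C j)) (quadraticBound N j N≤2j)))

twoStepBound-< : ∀ N j → N ≤ 2 * j → 2 ≤ j → j ≤ N →
                 2 * (suc (suc N) C suc (suc j)) < suc (suc N) * (N C j)
twoStepBound-< N j N≤2j 2≤j j≤N = *-cancelˡ-< (suc j * suc (suc j)) _ _
  (subst (_< suc j * suc (suc j) * (suc (suc N) * (N C j))) (sym (scaledTwoStep N j))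
    (*-monoˡ-< (suc (suc N) * (N C j)) ⦃ >-nonZero M>0 ⦄ (quadraticBound-< N j N≤2j 2≤j)))
  where
  M>0 : 0 < suc (suc N) * (N C j)
  M>0 = ≤-trans (binomial-pos j≤N) (m≤n*m (N C j) (suc (suc N)))

weightedPascal₂ : ∀ N j → suc (suc N) * pairFree N j + suc (suc N) * (N C j)
                          ≡ N * (suc (suc N) C suc (suc j)) + 2 * (suc (suc N) C suc (suc j))
weightedPascal₂ N j = begin
  suc (suc N) * pairFree N j + suc (suc N) * (N C j) ≡⟨ *-distribˡ-+ (suc (suc N)) (pairFree N j) (N C j) ⟨
  suc (suc N) * (pairFree N j + N C j)             ≡⟨ cong (suc (suc N) *_) (pascal₂ N j) ⟨
  suc (suc N) * c                                  ≡⟨ *-distribʳ-+ c 2 N ⟩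
  2 * c + N * c                                    ≡⟨ +-comm (2 * c) (N * c) ⟩
  N * c + 2 * c                                    ∎
  where
  open ≡-Reasoning
  c = suc (suc N) C suc (suc j)

blockBound : ∀ N j → N ≤ 2 * j → suc (suc N) * pairFree N j ≤ N * (suc (suc N) C suc (suc j))
blockBound N j N≤2j = +-cancelʳ-≤ (2 * c) (suc (suc N) * pairFree N j) (N * c)
  (subst (suc (suc N) * pairFree N j + 2 * c ≤_) (weightedPascal₂ N j) (+-monoʳ-≤ (suc (suc N) * pairFree N j) (twoStepBound N j N≤2j)))
  where c = suc (suc N) C suc (suc j)

blockBound-< : ∀ N j → N ≤ 2 * j → 2 ≤ j → j ≤ N →
               suc (suc N) * pairFree N j < N * (suc (suc N) C suc (suc j))
blockBound-< N j N≤2j 2≤j j≤N = +-cancelʳ-< (2 * c) (suc (suc N) * pairFree N j) (N * c)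
  (subst (suc (suc N) * pairFree N j + 2 * c <_) (weightedPascal₂ N j) (+-monoʳ-< (suc (suc N) * pairFree N j) (twoStepBound-< N j N≤2j 2≤j j≤N)))
  where c = suc (suc N) C suc (suc j)

transfer : ∀ N m A B c → A ≤ B → N * A ≤ m * B → suc (suc N) * B ≤ N * c → suc (suc N) * A ≤ m * c
transfer zero      m A B c A≤B _ 2B≤0 = ≤-trans (*-monoʳ-≤ 2 A≤B) (≤-trans 2B≤0 z≤n)
transfer N@(suc _) m A B c _ NA≤mB B≤c = *-cancelˡ-≤ N (begin
  N * (suc (suc N) * A) ≡⟨ x∙yz≈y∙xz N (suc (suc N)) A ⟩
  suc (suc N) * (N * A) ≤⟨ *-monoʳ-≤ (suc (suc N)) NA≤mB ⟩
  suc (suc N) * (m * B) ≡⟨ x∙yz≈y∙xz (suc (suc N)) m B ⟩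
  m * (suc (suc N) * B) ≤⟨ *-monoʳ-≤ m B≤c ⟩
  m * (N * c)           ≡⟨ x∙yz≈y∙xz m N c ⟩
  N * (m * c)           ∎)
  where open ≤-Reasoning

transfer-< : ∀ N m A B c → N * A ≤ suc m * B → suc (suc N) * B < N * c → suc (suc N) * A < suc m * c
transfer-< N@(suc _) m A B c NA≤mB B<c = *-cancelˡ-< N _ _ (begin-strict
  N * (suc (suc N) * A)     ≡⟨ x∙yz≈y∙xz N (suc (suc N)) A ⟩
  suc (suc N) * (N * A)     ≤⟨ *-monoʳ-≤ (suc (suc N)) NA≤mB ⟩
  suc (suc N) * (suc m * B) ≡⟨ x∙yz≈y∙xz (suc (suc N)) (suc m) B ⟩
  suc m * (suc (suc N) * B) <⟨ *-monoʳ-< (suc m) B<c ⟩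
  suc m * (N * c)           ≡⟨ x∙yz≈y∙xz (suc m) N c ⟩
  N * (suc m * c)           ∎)
  where open ≤-Reasoning

combine : ∀ N m x y u v → N * x ≤ m * u → N * y ≤ m * v → N * (x + 2 * y) ≤ m * (u + 2 * v)
combine N m x y u v Nx≤mu Ny≤mv = begin
  N * (x + 2 * y)       ≡⟨ *-distribˡ-+ N x (2 * y) ⟩
  N * x + N * (2 * y)   ≡⟨ cong (λ t → N * x + t) (x∙yz≈y∙xz N 2 y) ⟩
  N * x + 2 * (N * y)   ≤⟨ +-mono-≤ Nx≤mu (*-monoʳ-≤ 2 Ny≤mv) ⟩
  m * u + 2 * (m * v)   ≡⟨ cong (λ t → m * u + t) (x∙yz≈y∙xz 2 m v) ⟩
  m * u + m * (2 * v)   ≡⟨ *-distribˡ-+ m u (2 * v) ⟨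
  m * (u + 2 * v)       ∎
  where open ≤-Reasoning

halve : ∀ {n} k → 2 + n ≤ 2 * suc k → n ≤ 2 * k
halve {n} k h = +-cancelˡ-≤ 2 n (2 * k) (subst (2 + n ≤_) (*-suc 2 k) h)

levelUp : ∀ a m N j → (∀ k → 2 + N ≤ 2 * k → N * avoiding a N k ≤ m * (N C k)) → 2 + N ≤ 2 * suc j →
          avoiding (suc a) (2 + N) (2 + j) ≤ pairFree N j × N * avoiding (suc a) (2 + N) (2 + j) ≤ m * pairFree N j
levelUp a m N j bound h rewrite avoiding-step a N (suc j) =
    +-mono-≤ (avoiding≤binomial a N (2 + j)) (*-monoʳ-≤ 2 (avoiding≤binomial a N (suc j)))
  , combine N m _ _ _ _ (bound (2 + j) (≤-trans h (*-monoʳ-≤ 2 (n≤1+n (suc j))))) (bound (suc j) h)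

-- The size of a ground set made of a disjoint pairs followed by m further points.
groundSize : ℕ → ℕ → ℕ
groundSize zero    m = m
groundSize (suc a) m = 2 + groundSize a m

groundSize≡ : ∀ a m → groundSize a m ≡ 2 * a + m
groundSize≡ zero    m = refl
groundSize≡ (suc a) m = trans (cong (λ t → 2 + t) (groundSize≡ a m))
                              (sym (trans (cong (_+ m) (*-suc 2 a)) (+-assoc 2 (2 * a) m)))

avoidBound : ∀ a m k → 2 + groundSize a m ≤ 2 * k →
             groundSize a m * avoiding a (groundSize a m) k ≤ m * (groundSize a m C k)
avoidBound zero    m k             _ = ≤-reflexive (cong (m *_) (avoiding-none m k))
avoidBound (suc a) m zero          ()
avoidBound (suc a) m (suc zero)    (s≤s (s≤s ()))
avoidBound (suc a) m (suc (suc j)) h =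
  uncurry (transfer N m _ _ _) (levelUp a m N j (avoidBound a m) (halve (suc j) h))
                                (blockBound N j (halve j (halve (suc j) h)))
  where N = groundSize a m

avoidBound-< : ∀ a m k → 2 + groundSize (suc a) (suc m) ≤ 2 * k → 4 ≤ k → k ≤ groundSize (suc a) (suc m) →
  groundSize (suc a) (suc m) * avoiding (suc a) (groundSize (suc a) (suc m)) k
    < suc m * (groundSize (suc a) (suc m) C k)
avoidBound-< a m (suc (suc j)) h (s≤s (s≤s 2≤j)) (s≤s (s≤s j≤N)) =
  transfer-< N m _ _ _ (proj₂ (levelUp a (suc m) N j (avoidBound a (suc m)) (halve (suc j) h)))
                       (blockBound-< N j (halve j (halve (suc j) h)) 2≤j j≤N)
  where N = groundSize a (suc m)

sampleSize-aboveHalf : ∀ n → 2 + n ≤ 2 * sampleSize n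
sampleSize-aboveHalf n = ≤-pred (begin
  3 + n                       ≡⟨ +-comm 3 n ⟩
  n + 3                       ≡⟨ m≡m%n+[m/n]*n (n + 3) 2 ⟩
  (n + 3) % 2 + k * 2         ≤⟨ +-monoˡ-≤ (k * 2) (≤-pred (m%n<n (n + 3) 2)) ⟩
  1 + k * 2                   ≡⟨ cong suc (*-comm k 2) ⟩
  1 + 2 * k                   ∎)
  where
  open ≤-Reasoning
  k = sampleSize n

sampleSize≤ : ∀ n → 3 ≤ n → sampleSize n ≤ n
sampleSize≤ n 3≤n = *-cancelʳ-≤ (sampleSize n) n 2 (begin
  sampleSize n * 2 ≤⟨ m/n*n≤m (n + 3) 2 ⟩
  n + 3            ≤⟨ +-monoʳ-≤ n 3≤n ⟩
  n + n            ≡⟨ double n ⟩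
  n * 2            ∎)
  where
  open ≤-Reasoning
  double : ∀ n → n + n ≡ n * 2
  double = solve-∀

sampleSize≥4 : ∀ n → 5 ≤ n → 4 ≤ sampleSize n
sampleSize≥4 n 5≤n = *-cancelˡ-< 2 3 (sampleSize n) (≤-trans (+-monoʳ-≤ 2 5≤n) (sampleSize-aboveHalf n))

sampleSpace-size : ∀ n → length (sampleSpace n) ≡ n C sampleSize n
sampleSpace-size n = trans (length-filter (hasSize (sampleSize n)) (allSubsets n)) (count-hasSize n _)

favourable-size : ∀ a n → length (favourable a n) ≡ meeting a n (sampleSize n)
favourable-size a n = trans (length-filter (containsPair a) (sampleSpace n))
                            (count-filter (hasSize (sampleSize n)) (containsPair a) (allSubsets n))

sampleSpace-split : ∀ a n → length (sampleSpace n) ≡ length (favourable a n) + avoiding a n (sampleSize n)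
sampleSpace-split a n = trans (sampleSpace-size n)
  (trans (sym (meeting+avoiding a n k)) (cong (_+ avoiding a n k) (sym (favourable-size a n))))
  where k = sampleSize n

avoidingShare : ∀ a m n → 2 * a + m ≡ n →
                n * avoiding a n (sampleSize n) ≤ m * length (sampleSpace n)
avoidingShare a m n e with trans (groundSize≡ a m) e
... | refl = subst (λ s → n * avoiding a n (sampleSize n) ≤ m * s) (sym (sampleSpace-size n))
                   (avoidBound a m (sampleSize n) (sampleSize-aboveHalf n))

avoidingShare-< : ∀ a m n → 2 * suc a + suc m ≡ n → 5 ≤ n →
                  n * avoiding (suc a) n (sampleSize n) < suc m * length (sampleSpace n)
avoidingShare-< a m n e 5≤n with trans (groundSize≡ (suc a) (suc m)) e
... | refl = subst (λ s → n * avoiding (suc a) n (sampleSize n) < suc m * s) (sym (sampleSpace-size n))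
                   (avoidBound-< a m (sampleSize n) (sampleSize-aboveHalf n) (sampleSize≥4 n 5≤n)
                                 (sampleSize≤ n (≤-trans (m≤n+m 3 2) 5≤n)))

-- From the avoiding proportion to the meeting proportion: with n = 2a + m and S = F + V,
-- 2a·S + m·S = F·n + n·V, so n·V ≤ m·S (resp. <) gives 2a·S ≤ F·n (resp. <).
shareIdentity : ∀ a₂ m n S F V → a₂ + m ≡ n → S ≡ F + V → a₂ * S + m * S ≡ F * n + n * V
shareIdentity a₂ m n S F V refl refl = begin
  a₂ * S + m * S  ≡⟨ *-distribʳ-+ S a₂ m ⟨
  n * (F + V)     ≡⟨ *-distribˡ-+ n F V ⟩
  n * F + n * V   ≡⟨ cong (_+ n * V) (*-comm n F) ⟩
  F * n + n * V   ∎
  where open ≡-Reasoning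

meetingShare : ∀ a₂ m n S F V → a₂ + m ≡ n → S ≡ F + V → n * V ≤ m * S → a₂ * S ≤ F * n
meetingShare a₂ m n S F V e s nV≤mS = +-cancelʳ-≤ (m * S) (a₂ * S) (F * n)
  (subst (_≤ F * n + m * S) (sym (shareIdentity a₂ m n S F V e s)) (+-monoʳ-≤ (F * n) nV≤mS))

meetingShare-< : ∀ a₂ m n S F V → a₂ + m ≡ n → S ≡ F + V → n * V < m * S → a₂ * S < F * n
meetingShare-< a₂ m n S F V e s nV<mS = +-cancelʳ-< (m * S) (a₂ * S) (F * n)
  (subst (_< F * n + m * S) (sym (shareIdentity a₂ m n S F V e s)) (+-monoʳ-< (F * n) nV<mS))

toℚᵘ-/ : ∀ m d .{{_ : NonZero d}} → toℚᵘ ((+ m) /ℚ d) ≃ᵘ mkℚᵘ (+ m) (pred d)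
toℚᵘ-/ m (suc d) = toℚᵘ-fromℚᵘ (mkℚᵘ (+ m) d)

/-≤ : ∀ a b c d .{{_ : NonZero b}} .{{_ : NonZero d}} → a * d ≤ c * b → (+ a) /ℚ b ≤ℚ (+ c) /ℚ d
/-≤ a b@(suc _) c d@(suc _) ad≤cb = toℚᵘ-cancel-≤
  (≤-respˡ-≃ (≃-sym (toℚᵘ-/ a b)) (≤-respʳ-≃ (≃-sym (toℚᵘ-/ c d))
    (*≤* (subst₂ ℤ._≤_ (pos-* a d) (pos-* c b) (ℤ.+≤+ ad≤cb)))))

/-< : ∀ a b c d .{{_ : NonZero b}} .{{_ : NonZero d}} → a * d < c * b → (+ a) /ℚ b <ℚ (+ c) /ℚ d
/-< a b@(suc _) c d@(suc _) ad<cb = toℚᵘ-cancel-<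
  (<-respˡ-≃ (≃-sym (toℚᵘ-/ a b)) (<-respʳ-≃ (≃-sym (toℚᵘ-/ c d))
    (*<* (subst₂ ℤ._<_ (pos-* a d) (pos-* c b) (ℤ.+<+ ad<cb)))))

/-≡ : ∀ a b c d .{{_ : NonZero b}} .{{_ : NonZero d}} → a * d ≡ c * b → (+ a) /ℚ b ≡ (+ c) /ℚ d
/-≡ a b@(suc _) c d@(suc _) ad≡cb = toℚᵘ-injective (≃-trans (toℚᵘ-/ a b) (≃-trans
  (*≡* (trans (sym (pos-* a d)) (trans (cong +_ ad≡cb) (pos-* c b)))) (≃-sym (toℚᵘ-/ c d))))

p-lowerBound : ∀ a m n .{{_ : NonZero n}} .{{_ : NonZero (length (sampleSpace n))}} →
               2 * a + m ≡ n → (+ (2 * a)) /ℚ n ≤ℚ p a n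
p-lowerBound a m n e = /-≤ (2 * a) n F S
  (meetingShare (2 * a) m n S F (avoiding a n (sampleSize n)) e (sampleSpace-split a n) (avoidingShare a m n e))
  where
  S = length (sampleSpace n)
  F = length (favourable a n)

p-strictBound : ∀ a m n .{{_ : NonZero n}} .{{_ : NonZero (length (sampleSpace n))}} →
                1 ≤ a → 2 * a + suc m ≡ n → 5 ≤ n → (+ (2 * a)) /ℚ n <ℚ p a n
p-strictBound a@(suc a-1) m n _ e 5≤n = /-< (2 * a) n F S
  (meetingShare-< (2 * a) (suc m) n S F (avoiding a n (sampleSize n)) e (sampleSpace-split a n)
                  (avoidingShare-< a-1 m n e 5≤n))
  where
  S = length (sampleSpace n)
  F = length (favourable a n)

-- p(a,n) = 1 = 2a/n when 2a = n: no sample avoids all pairs.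
p-tight : ∀ a n .{{_ : NonZero n}} .{{_ : NonZero (length (sampleSpace n))}} →
          2 * a ≡ n → p a n ≡ (+ (2 * a)) /ℚ n
p-tight a n e = /-≡ F S (2 * a) n (begin
  F * n       ≡⟨ *-comm F n ⟩
  n * F       ≡⟨ cong (n *_) (sym S≡F) ⟩
  n * S       ≡⟨ cong (_* S) (sym e) ⟩
  2 * a * S   ∎)
  where
  open ≡-Reasoning
  S = length (sampleSpace n)
  F = length (favourable a n)
  V = avoiding a n (sampleSize n)
  nV≡0 : n * V ≡ 0
  nV≡0 = n≤0⇒n≡0 (avoidingShare a 0 n (trans (+-identityʳ (2 * a)) e))
  S≡F : S ≡ F
  S≡F = trans (sampleSpace-split a n)
              (trans (cong (λ v → F + v) (m*n≡0⇒m≡0 V n (trans (*-comm V n) nV≡0))) (+-identityʳ F))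

lemma9 : (a n : ℕ) → 1 ≤ a → 5 ≤ n → 2 * a ≤ n →
    .{{_ : NonZero n}} → .{{_ : NonZero (length (sampleSpace n))}} →
    ((+ (2 * a)) /ℚ n ≤ℚ p a n)
    × ((p a n ≡ (+ (2 * a)) /ℚ n) ⇔ (2 * a ≡ n))
lemma9 a n 1≤a 5≤n 2a≤n with m≤n⇒∃[o]m+o≡n 2a≤n
... | zero  , 2a+0≡n = p-lowerBound a 0 n 2a+0≡n , mk⇔ (λ _ → 2a≡n) (λ _ → p-tight a n 2a≡n)
  where
  2a≡n : 2 * a ≡ n
  2a≡n = trans (sym (+-identityʳ (2 * a))) 2a+0≡n
... | suc m , 2a+m≡n = p-lowerBound a (suc m) n 2a+m≡n , mk⇔ notTight notEven
  where
  notTight : p a n ≡ (+ (2 * a)) /ℚ n → 2 * a ≡ n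
  notTight p≡ = ⊥-elim (<ℚ-irrefl (sym p≡) (p-strictBound a m n 1≤a 2a+m≡n 5≤n))
  notEven : 2 * a ≡ n → p a n ≡ (+ (2 * a)) /ℚ n
  notEven 2a≡n = ⊥-elim (m+1+n≢m (2 * a) (trans 2a+m≡n (sym 2a≡n)))
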